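{- The assignment $c\mapsto\langle c\rangle$ is a morphism of props $\mathsf{ACirc}\to\mathsf{Traj}$: it is well defined on $\mathsf{ACirc}$, sends circuits of sort $(n,m)$ to sets of $(n,m)$-trajectories, and satisfies $\langle c;d\rangle=\langle c\rangle;\langle d\rangle$, $\langle c\oplus d\rangle=\langle c\rangle\oplus\langle d\rangle$, and maps identities and symmetries of $\mathsf{ACirc}$ to those of $\mathsf{Traj}$.
   Context: Fix a field $k$. Circuits and their sorts $(n,m)$ ($n$ left ports, $m$ right ports) are generated as follows. Generators: copier $\Delta:(1,2)$, discard $!:(1,0)$, adder $\mu:(2,1)$, zero $\mathsf 0:(0,1)$, one $\mathsf 1:(0,1)$, register $\mathsf x:(1,1)$, amplifier $\mathsf s_r:(1,1)$ for each $r\in k$, and their mirror images $\Delta^{op}:(2,1)$, $!^{op}:(0,1)$, $\mu^{op}:(1,2)$, $\mathsf 0^{op}:(1,0)$, $\mathsf 1^{op}:(1,0)$, $\mathsf x^{op}:(1,1)$, $\mathsf s_r^{op}:(1,1)$; also $\mathrm{id}_0:(0,0)$, $\mathrm{id}_1:(1,1)$, $\mathrm{sw}:(2,2)$. If $c:(n,z)$, $d:(z,m)$ then $c;d:(n,m)$; if $c:(n,m)$, $d:(r,z)$ then $c\oplus d:(n+r,m+z)$. $\mathsf{ACirc}$ is the prop whose arrows $n\to m$ are circuits of sort $(n,m)$ modulo the laws of symmetric monoidal categories. Operational semantics: a state of a circuit is the circuit with a value of $k$ stored in each occurrence of $\mathsf x$ and $\mathsf x^{op}$. Transitions $t\vdash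 c\to t+1\vdash c'$ ($t\in\mathbb Z$) carry a left label $u\in k^n$ and a right label $v\in k^m$, generated by (for all $a,b\in k$): $\Delta$: left $a$, right $(a,a)$; $!$: left $a$, right $\bullet$ (the empty vector); $\mu$: left $(a,b)$, right $a+b$; $\mathsf 0$: left $\bullet$, right $0$; $\mathsf s_r$: left $b$, right $rb$; $\mathsf x$ storing $b$: left $a$, right $b$, new state stores $a$; $\mathsf 1$: left $\bullet$, right $1$ if $t=0$, right $0$ if $t\ne0$. $\Delta^{op}$: left $(a,a)$, right $a$; $!^{op}$: left $\bullet$, right $a$; $\mu^{op}$: left $a+b$, right $(a,b)$; $\mathsf 0^{op}$: left $0$, right $\bullet$; $\mathsf s_r^{op}$: left $rb$, right $b$; $\mathsf x^{op}$ storing $b$: left $b$, right $a$, new state stores $a$; $\mathsf 1^{op}$: left $1$ if $t=0$, left $0$ otherwise, right $\bullet$. $\mathrm{id}_1$: left $a$, right $a$; $\mathrm{sw}$: left $(a,b)$, right $(b,a)$; $\mathrm{id}_0$: both labels $\bullet$. If at time $t$, $c$ moves to $c'$ with labels $u,v$ and $d$ to $d'$ with labels $v,w$, then $c;d$ moves to $c';d'$ with labels $u,w$; if $c$ moves with labels $u_1,v_1$ and $d$ with $u_2,v_2$, then $c\oplus d$ moves to $c'\oplus d'$ with labels $(u_1,u_2),(v_1,v_2)$. The initial state $c_0$ stores $0$ in every register. A computation starting at time $t\le0$ is a sequence of transitions $t\vdash c_0\to c_1\to\cdots$, the $j$-th occurring at time $t+j$. An $(n,m)$-trajectory is a map $\sigma:\mathbb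 Z\to k^n\times k^m$ such that for some $j\in\mathbb Z$, $\sigma(i)=(0,0)$ for all $i\le j$; write $\sigma=\langle\sigma_l,\sigma_r\rangle$. An infinite computation starting at $t$ with labels $(u_i,v_i)$ at time $i$ yields the trajectory $\sigma(i)=(u_i,v_i)$ for $i\ge t$ and $(0,0)$ for $i<t$. $\langle c\rangle$ is the set of trajectories yielded by all infinite computations of $c$ (starting at any $t\le0$). $\mathsf{Traj}$: arrows $n\to m$ are sets of $(n,m)$-trajectories; $S;T=\{\langle\sigma_l,\tau_r\rangle\mid\sigma\in S,\tau\in T,\sigma_r=\tau_l\}$; $S_1\oplus S_2=\{\sigma_1\oplus\sigma_2\mid \sigma_i\in S_i\}$ where $(\sigma_1\oplus\sigma_2)(i)$ stacks the left and right components of $\sigma_1(i)$ and $\sigma_2(i)$; identity on $n$ is the set of all $(n,n)$-trajectories $\sigma$ with $\sigma_l=\sigma_r$. -}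

module Defs where

open import Data.Nat as ℕ using (ℕ; zero; suc)
open import Data.Nat.Properties using (+-assoc; +-identityʳ)
open import Data.Integer as ℤ using (ℤ; +_)
open import Data.Vec using (Vec; []; _∷_; _++_; replicate; take; drop)
open import Data.Product using (Σ; ∃; ∃-syntax; _×_; _,_)
open import Data.Unit using (⊤; tt)
open import Relation.Nullary using (¬_)
open import Relation.Binary.PropositionalEquality using (_≡_; _≢_; subst; subst₂; sym)
open import Algebra.Structures using (IsCommutativeRing)

record Field : Set₁ where
  field
    Carrier : Set
    _+ₖ_ _*ₖ_ : Carrier → Carrier → Carrier
    -ₖ_ : Carrier → Carrier
    0ₖ 1ₖ : Carrier
    isCommutativeRing : IsCommutativeRing _≡_ _+ₖ_ _*ₖ_ -ₖ_ 0ₖ 1ₖ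
    0≢1 : 0ₖ ≢ 1ₖ
    inverse : ∀ x → x ≢ 0ₖ → ∃[ y ] (x *ₖ y ≡ 1ₖ)

module Semantics (F : Field) where
  open Field F renaming (Carrier to K)

  infixr 9 _⨾_
  infixr 10 _⊕_

  data Circ : ℕ → ℕ → Set where
    copy   : Circ 1 2
    disc   : Circ 1 0
    add    : Circ 2 1
    zero₀  : Circ 0 1
    one    : Circ 0 1
    reg    : Circ 1 1
    amp    : K → Circ 1 1
    copyᵒᵖ : Circ 2 1
    discᵒᵖ : Circ 0 1
    addᵒᵖ  : Circ 1 2
    zeroᵒᵖ : Circ 1 0
    oneᵒᵖ  : Circ 1 0
    regᵒᵖ  : Circ 1 1
    ampᵒᵖ  : K → Circ 1 1
    id₀    : Circ 0 0
    id₁    : Circ 1 1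
    sw     : Circ 2 2
    _⨾_    : ∀ {n z m} → Circ n z → Circ z m → Circ n m
    _⊕_    : ∀ {n m r z} → Circ n m → Circ r z → Circ (n ℕ.+ r) (m ℕ.+ z)

  idC : ∀ n → Circ n n
  idC zero    = id₀
  idC (suc n) = id₁ ⊕ idC n

  τ : ∀ m → Circ (1 ℕ.+ m) (m ℕ.+ 1)
  τ zero    = id₁
  τ (suc m) = (sw ⊕ idC m) ⨾ (id₁ ⊕ τ m)

  σC : ∀ n m → Circ (n ℕ.+ m) (m ℕ.+ n)
  σC zero    m = subst (Circ m) (sym (+-identityʳ m)) (idC m)
  σC (suc n) m = subst (Circ (suc (n ℕ.+ m))) (+-assoc m 1 n)
                   ((id₁ ⊕ σC n m) ⨾ (τ m ⊕ idC n))

  -- The laws of (strict) symmetric monoidal categories; ACirc is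
  -- Circ n m modulo this congruence.

  infix 4 _≈_
  data _≈_ : ∀ {n m} → Circ n m → Circ n m → Set where
    ≈-refl  : ∀ {n m} {c : Circ n m} → c ≈ c
    ≈-sym   : ∀ {n m} {c d : Circ n m} → c ≈ d → d ≈ c
    ≈-trans : ∀ {n m} {c d e : Circ n m} → c ≈ d → d ≈ e → c ≈ e
    ⨾-cong  : ∀ {n z m} {c c' : Circ n z} {d d' : Circ z m} →
              c ≈ c' → d ≈ d' → c ⨾ d ≈ c' ⨾ d'
    ⊕-cong  : ∀ {n m r z} {c c' : Circ n m} {d d' : Circ r z} →
              c ≈ c' → d ≈ d' → c ⊕ d ≈ c' ⊕ d'
    ⨾-assoc : ∀ {n z w m} (c : Circ n z) (d : Circ z w) (e : Circ w m) →
              (c ⨾ d) ⨾ e ≈ c ⨾ (d ⨾ e)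
    ⨾-idˡ   : ∀ {n m} (c : Circ n m) → idC n ⨾ c ≈ c
    ⨾-idʳ   : ∀ {n m} (c : Circ n m) → c ⨾ idC m ≈ c
    ⊕-assoc : ∀ {n m r z p q} (c : Circ n m) (d : Circ r z) (e : Circ p q) →
              subst₂ Circ (+-assoc n r p) (+-assoc m z q) ((c ⊕ d) ⊕ e)
                ≈ c ⊕ (d ⊕ e)
    ⊕-idˡ   : ∀ {n m} (c : Circ n m) → id₀ ⊕ c ≈ c
    ⊕-idʳ   : ∀ {n m} (c : Circ n m) →
              subst₂ Circ (+-identityʳ n) (+-identityʳ m) (c ⊕ id₀) ≈ c
    interchange : ∀ {n z m r w q} (c : Circ n z) (d : Circ z m)
                    (c' : Circ r w) (d' : Circ w q) →
              (c ⨾ d) ⊕ (c' ⨾ d') ≈ (c ⊕ c') ⨾ (d ⊕ d')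
    id-⊕    : ∀ n m → idC n ⊕ idC m ≈ idC (n ℕ.+ m)
    σ-inv   : ∀ n m → σC n m ⨾ σC m n ≈ idC (n ℕ.+ m)
    σ-nat   : ∀ {n m r z} (c : Circ n m) (d : Circ r z) →
              (c ⊕ d) ⨾ σC m z ≈ σC n r ⨾ (d ⊕ c)
    σ-hex   : ∀ n m r →
              subst (λ a → Circ a ((m ℕ.+ r) ℕ.+ n)) (+-assoc n m r)
                ((σC n m ⊕ idC r) ⨾ subst₂ Circ (sym (+-assoc m n r)) (sym (+-assoc m r n)) (idC m ⊕ σC n r))
                ≈ σC n (m ℕ.+ r)

  -- states: a value of k in each occurrence of x and x^op
  State : ∀ {n m} → Circ n m → Set
  State reg     = K
  State regᵒᵖ   = K
  State (c ⨾ d) = State c × State d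
  State (c ⊕ d) = State c × State d
  State _       = ⊤

  init : ∀ {n m} (c : Circ n m) → State c
  init copy    = tt
  init disc    = tt
  init add     = tt
  init zero₀   = tt
  init one     = tt
  init reg     = 0ₖ
  init (amp r) = tt
  init copyᵒᵖ  = tt
  init discᵒᵖ  = tt
  init addᵒᵖ   = tt
  init zeroᵒᵖ  = tt
  init oneᵒᵖ   = tt
  init regᵒᵖ   = 0ₖ
  init (ampᵒᵖ r) = tt
  init id₀     = tt
  init id₁     = tt
  init sw      = tt
  init (c ⨾ d) = init c , init d
  init (c ⊕ d) = init c , init d

  -- Step t c s u v s' :  t ⊢ (c,s) --u/v--> t+1 ⊢ (c,s')
  data Step : ℤ → ∀ {n m} (c : Circ n m) → State c → Vec K n → Vec K m → State c → Set where
    st-copy  : ∀ {t} a → Step t copy tt (a ∷ []) (a ∷ a ∷ []) tt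
    st-disc  : ∀ {t} a → Step t disc tt (a ∷ []) [] tt
    st-add   : ∀ {t} a b → Step t add tt (a ∷ b ∷ []) ((a +ₖ b) ∷ []) tt
    st-zero  : ∀ {t} → Step t zero₀ tt [] (0ₖ ∷ []) tt
    st-amp   : ∀ {t} r b → Step t (amp r) tt (b ∷ []) ((r *ₖ b) ∷ []) tt
    st-reg   : ∀ {t} a b → Step t reg b (a ∷ []) (b ∷ []) a
    st-one₀  : Step (+ 0) one tt [] (1ₖ ∷ []) tt
    st-one   : ∀ {t} → t ≢ + 0 → Step t one tt [] (0ₖ ∷ []) tt
    st-copyᵒᵖ : ∀ {t} a → Step t copyᵒᵖ tt (a ∷ a ∷ []) (a ∷ []) tt
    st-discᵒᵖ : ∀ {t} a → Step t discᵒᵖ tt [] (a ∷ []) tt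
    st-addᵒᵖ  : ∀ {t} a b → Step t addᵒᵖ tt ((a +ₖ b) ∷ []) (a ∷ b ∷ []) tt
    st-zeroᵒᵖ : ∀ {t} → Step t zeroᵒᵖ tt (0ₖ ∷ []) [] tt
    st-ampᵒᵖ  : ∀ {t} r b → Step t (ampᵒᵖ r) tt ((r *ₖ b) ∷ []) (b ∷ []) tt
    st-regᵒᵖ  : ∀ {t} a b → Step t regᵒᵖ b (b ∷ []) (a ∷ []) a
    st-one₀ᵒᵖ : Step (+ 0) oneᵒᵖ tt (1ₖ ∷ []) [] tt
    st-oneᵒᵖ  : ∀ {t} → t ≢ + 0 → Step t oneᵒᵖ tt (0ₖ ∷ []) [] tt
    st-id₀   : ∀ {t} → Step t id₀ tt [] [] tt
    st-id₁   : ∀ {t} a → Step t id₁ tt (a ∷ []) (a ∷ []) tt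
    st-sw    : ∀ {t} a b → Step t sw tt (a ∷ b ∷ []) (b ∷ a ∷ []) tt
    st-seq   : ∀ {t n z m} {c : Circ n z} {d : Circ z m} {s₁ s₁' s₂ s₂'}
                 {u : Vec K n} {v : Vec K z} {w : Vec K m} →
               Step t c s₁ u v s₁' → Step t d s₂ v w s₂' →
               Step t (c ⨾ d) (s₁ , s₂) u w (s₁' , s₂')
    st-par   : ∀ {t n m r z} {c : Circ n m} {d : Circ r z} {s₁ s₁' s₂ s₂'}
                 {u₁ : Vec K n} {v₁ : Vec K m} {u₂ : Vec K r} {v₂ : Vec K z} →
               Step t c s₁ u₁ v₁ s₁' → Step t d s₂ u₂ v₂ s₂' →
               Step t (c ⊕ d) (s₁ , s₂) (u₁ ++ u₂) (v₁ ++ v₂) (s₁' , s₂')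

  record Computation {n m} (c : Circ n m) (t : ℤ) : Set where
    field
      state  : ℕ → State c
      start  : state 0 ≡ init c
      left   : ℕ → Vec K n
      right  : ℕ → Vec K m
      steps  : ∀ j → Step (t ℤ.+ + j) c (state j) (left j) (right j) (state (suc j))

  Signal : ℕ → ℕ → Set
  Signal n m = ℤ → Vec K n × Vec K m

  zeros : ∀ {n m} → Vec K n × Vec K m
  zeros = replicate _ 0ₖ , replicate _ 0ₖ

  IsTrajectory : ∀ {n m} → Signal n m → Set
  IsTrajectory σ = ∃[ j ] (∀ i → i ℤ.≤ j → σ i ≡ zeros)

  lft : ∀ {n m} → Signal n m → ℤ → Vec K n
  lft σ i = Data.Product.proj₁ (σ i)
  rgt : ∀ {n m} → Signal n m → ℤ → Vec K m
  rgt σ i = Data.Product.proj₂ (σ i)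

  TSet : ℕ → ℕ → Set₁
  TSet n m = Signal n m → Set

  infix 4 _≐_
  _≐_ : ∀ {n m} → TSet n m → TSet n m → Set
  S ≐ T = ∀ σ → (S σ → T σ) × (T σ → S σ)

  Yields : ∀ {n m} {c : Circ n m} {t : ℤ} → Computation c t → Signal n m → Set
  Yields {t = t} C σ =
    (∀ i → i ℤ.< t → σ i ≡ zeros) ×
    (∀ (j : ℕ) → σ (t ℤ.+ + j) ≡ (Computation.left C j , Computation.right C j))

  ⟦_⟧ : ∀ {n m} → Circ n m → TSet n m
  ⟦ c ⟧ σ = ∃[ t ] (t ℤ.≤ + 0 × Σ (Computation c t) λ C → Yields C σ)

  _⨾T_ : ∀ {n z m} → TSet n z → TSet z m → TSet n m
  (S ⨾T T) ρ = ∃[ σ ] ∃[ τ′ ] (S σ × T τ′ × (∀ i → rgt σ i ≡ lft τ′ i) ×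
                  (∀ i → ρ i ≡ (lft σ i , rgt τ′ i)))

  _⊕T_ : ∀ {n m r z} → TSet n m → TSet r z → TSet (n ℕ.+ r) (m ℕ.+ z)
  (S₁ ⊕T S₂) ρ = ∃[ σ₁ ] ∃[ σ₂ ] (S₁ σ₁ × S₂ σ₂ ×
                  (∀ i → ρ i ≡ (lft σ₁ i ++ lft σ₂ i , rgt σ₁ i ++ rgt σ₂ i)))

  idT : ∀ n → TSet n n
  idT n ρ = IsTrajectory ρ × (∀ i → lft ρ i ≡ rgt ρ i)

  symT : ∀ n m → TSet (n ℕ.+ m) (m ℕ.+ n)
  symT n m ρ = IsTrajectory ρ ×
               (∀ i → rgt ρ i ≡ drop n (lft ρ i) ++ take n (lft ρ i))

module Submission where

-- Two facts carry the proof.  First, compositionality: a computation of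
-- c ⨾ d (resp. c ⊕ d) is the same thing as a pair of computations of c and d
-- started at the same time and agreeing on the shared boundary.  Computations
-- started at different times t ≤ 0 can be aligned, because from its initial
-- state every circuit can idle on zero inputs at any time t ≠ 0 (all
-- generators map zeros to zeros; only the constant 1 fires, at time 0), so a
-- computation may always be restarted earlier.  This yields
-- ⟦ c ⨾ d ⟧ = ⟦ c ⟧ ⨾T ⟦ d ⟧ and ⟦ c ⊕ d ⟧ = ⟦ c ⟧ ⊕T ⟦ d ⟧.  Second, wiring
-- is stateless: identities, symmetries and whatever is built from them
-- compute a fixed map of vectors at every step, and the semantics of such a
-- circuit is the graph of that map.  Each symmetric monoidal law is then
-- sound either by compositionality plus the corresponding law of Traj, or
-- because both sides compute the same map.

open import Defs
open import Data.Nat as ℕ using (ℕ; zero; suc)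
import Data.Nat.Properties as ℕP
open import Data.Integer as ℤ using (ℤ; +_; -[1+_])
import Data.Integer.Properties as ℤP
open import Data.Integer.Tactic.RingSolver using (solve-∀)
open import Data.Vec using (Vec; []; _∷_; _++_; replicate; take; drop; cast)
open import Data.Vec.Properties
  using (++-injective; ++-assoc-eqFree; ++-identityʳ-eqFree; take++drop≡id; cast-sym)
open import Data.Vec.Relation.Binary.Equality.Cast using (cast-is-id)
open import Data.Product using (Σ; ∃-syntax; _×_; _,_; proj₁; proj₂)
open import Data.Sum using (inj₁; inj₂)
open import Relation.Nullary using (¬_; contradiction)
open import Relation.Binary.PropositionalEquality
open import Algebra.Structures using (IsCommutativeRing)

t+[i-t]≡i : ∀ t i → t ℤ.+ (i ℤ.- t) ≡ i
t+[i-t]≡i = solve-∀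

[t+i]-t≡i : ∀ t i → (t ℤ.+ i) ℤ.- t ≡ i
[t+i]-t≡i = solve-∀

t+-[1+k]<t : ∀ t k → t ℤ.+ -[1+ k ] ℤ.< t
t+-[1+k]<t t k = subst (t ℤ.+ -[1+ k ] ℤ.<_) (ℤP.+-identityʳ t) (ℤP.+-monoʳ-< t ℤ.-<+)

t+j≮t : ∀ t j → ¬ (t ℤ.+ + j ℤ.< t)
t+j≮t t j lt = ℤP.<⇒≱ lt (ℤP.i≤i+j t (+ j))

data Instant (t : ℤ) : ℤ → Set where
  before : ∀ {i} → i ℤ.< t → Instant t i
  at     : ∀ j → Instant t (t ℤ.+ + j)

instant : ∀ t i → Instant t i
instant t i with i ℤ.- t | t+[i-t]≡i t i
... | + j      | refl = at j
... | -[1+ k ] | t-k-1≡i = before (subst (ℤ._< t) t-k-1≡i (t+-[1+k]<t t k))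

by-instant : ∀ {ℓ} (P : ℤ → Set ℓ) t →
             (∀ i → i ℤ.< t → P i) → (∀ j → P (t ℤ.+ + j)) → ∀ i → P i
by-instant P t P-before P-at i with instant t i
... | before i<t = P-before i i<t
... | at j       = P-at j

module _ {A : Set} where

  replicate-++ : ∀ n m (x : A) → replicate (n ℕ.+ m) x ≡ replicate n x ++ replicate m x
  replicate-++ zero    m x = refl
  replicate-++ (suc n) m x = cong (x ∷_) (replicate-++ n m x)

  take-++ : ∀ {n r} (a : Vec A n) (b : Vec A r) → take n (a ++ b) ≡ a
  take-++ []      b = refl
  take-++ (x ∷ a) b = cong (x ∷_) (take-++ a b)

  drop-++ : ∀ {n r} (a : Vec A n) (b : Vec A r) → drop n (a ++ b) ≡ b
  drop-++ []      b = refl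
  drop-++ (x ∷ a) b = drop-++ a b

  []-unique : (v : Vec A 0) → v ≡ []
  []-unique [] = refl

  cast-transpose : ∀ {a b} (p : a ≡ b) {x : Vec A b} {y : Vec A a} → cast (sym p) x ≡ y → x ≡ cast p y
  cast-transpose p e = sym (cast-sym (sym p) e)

  swap : ∀ n m → Vec A (n ℕ.+ m) → Vec A (m ℕ.+ n)
  swap n m u = drop n u ++ take n u

  swap-++ : ∀ {n m} (a : Vec A n) (b : Vec A m) → swap n m (a ++ b) ≡ b ++ a
  swap-++ a b = cong₂ _++_ (drop-++ a b) (take-++ a b)

  swap-++⁻¹ : ∀ n r (v : Vec A (n ℕ.+ r)) (a : Vec A n) (b : Vec A r) → swap n r v ≡ b ++ a → v ≡ a ++ b
  swap-++⁻¹ n r v a b e with ++-injective (drop n v) b e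
  ... | drop≡b , take≡a = trans (sym (take++drop≡id n v)) (cong₂ _++_ take≡a drop≡b)

module Soundness (F : Field) where
  open Field F renaming (Carrier to K)
  open Semantics F
  open IsCommutativeRing isCommutativeRing using (zeroʳ) renaming (+-identityʳ to +ₖ-identityʳ)

  ++-silent : ∀ {n m} {a : Vec K n} {b : Vec K m} →
              a ≡ replicate n 0ₖ → b ≡ replicate m 0ₖ → a ++ b ≡ replicate (n ℕ.+ m) 0ₖ
  ++-silent {n} {m} refl refl = sym (replicate-++ n m 0ₖ)

  silent-with⇒trajectory : ∀ {n m r z a b} (σ₁ : Signal n m) (σ₂ : Signal r z) (G : Signal a b) →
    IsTrajectory σ₁ → IsTrajectory σ₂ → (∀ i → σ₁ i ≡ zeros → σ₂ i ≡ zeros → G i ≡ zeros) →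
    IsTrajectory G
  silent-with⇒trajectory σ₁ σ₂ G (j₁ , Z₁) (j₂ , Z₂) h with ℤP.≤-total j₁ j₂
  ... | inj₁ j₁≤j₂ = j₁ , λ i i≤j₁ → h i (Z₁ i i≤j₁) (Z₂ i (ℤP.≤-trans i≤j₁ j₁≤j₂))
  ... | inj₂ j₂≤j₁ = j₂ , λ i i≤j₂ → h i (Z₁ i (ℤP.≤-trans i≤j₂ j₂≤j₁)) (Z₂ i i≤j₂)

  castSig : ∀ {n n' m m'} → n ≡ n' → m ≡ m' → Signal n' m' → Signal n m
  castSig p q ρ i = cast (sym p) (lft ρ i) , cast (sym q) (rgt ρ i)

  ≐-refl : ∀ {n m} {S : TSet n m} → S ≐ S
  ≐-refl σ = (λ x → x) , (λ x → x)

  ≐-sym : ∀ {n m} {S T : TSet n m} → S ≐ T → T ≐ S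
  ≐-sym S≐T σ = proj₂ (S≐T σ) , proj₁ (S≐T σ)

  ≐-trans : ∀ {n m} {S T U : TSet n m} → S ≐ T → T ≐ U → S ≐ U
  ≐-trans S≐T T≐U σ = (λ x → proj₁ (T≐U σ) (proj₁ (S≐T σ) x)) , (λ x → proj₂ (S≐T σ) (proj₂ (T≐U σ) x))

  ≐-castSig : ∀ {n n' m m'} {S T : TSet n m} (p : n ≡ n') (q : m ≡ m') →
              S ≐ T → (λ ρ → S (castSig p q ρ)) ≐ (λ ρ → T (castSig p q ρ))
  ≐-castSig p q S≐T ρ = S≐T (castSig p q ρ)

  ⨾T-cong : ∀ {n z m} {S S' : TSet n z} {T T' : TSet z m} → S ≐ S' → T ≐ T' → (S ⨾T T) ≐ (S' ⨾T T')
  ⨾T-cong S≐ T≐ ρ = (λ (σ , τ , Sσ , Tτ , mt , e) → σ , τ , proj₁ (S≐ σ) Sσ , proj₁ (T≐ τ) Tτ , mt , e)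
                  , (λ (σ , τ , Sσ , Tτ , mt , e) → σ , τ , proj₂ (S≐ σ) Sσ , proj₂ (T≐ τ) Tτ , mt , e)

  ⊕T-cong : ∀ {n m r z} {S S' : TSet n m} {T T' : TSet r z} → S ≐ S' → T ≐ T' → (S ⊕T T) ≐ (S' ⊕T T')
  ⊕T-cong S≐ T≐ ρ = (λ (σ , τ , Sσ , Tτ , e) → σ , τ , proj₁ (S≐ σ) Sσ , proj₁ (T≐ τ) Tτ , e)
                  , (λ (σ , τ , Sσ , Tτ , e) → σ , τ , proj₂ (S≐ σ) Sσ , proj₂ (T≐ τ) Tτ , e)

  ⨾T-assoc : ∀ {n z w m} (S : TSet n z) (T : TSet z w) (U : TSet w m) →
             ((S ⨾T T) ⨾T U) ≐ (S ⨾T (T ⨾T U))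
  ⨾T-assoc S T U ρ = to , from
    where
    to : ((S ⨾T T) ⨾T U) ρ → (S ⨾T (T ⨾T U)) ρ
    to (α , υ , (σ , τ , Sσ , Tτ , m₁ , eα) , Uυ , m₂ , e) =
      σ , (λ i → lft τ i , rgt υ i) , Sσ ,
      (τ , υ , Tτ , Uυ , (λ i → trans (sym (cong proj₂ (eα i))) (m₂ i)) , (λ i → refl)) ,
      m₁ , (λ i → trans (e i) (cong (_, rgt υ i) (cong proj₁ (eα i))))
    from : (S ⨾T (T ⨾T U)) ρ → ((S ⨾T T) ⨾T U) ρ
    from (σ , β , Sσ , (τ , υ , Tτ , Uυ , m₂ , eβ) , m₁ , e) =
      (λ i → lft σ i , rgt τ i) , υ ,
      (σ , τ , Sσ , Tτ , (λ i → trans (m₁ i) (cong proj₁ (eβ i))) , (λ i → refl)) , Uυ ,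
      m₂ , (λ i → trans (e i) (cong (lft σ i ,_) (cong proj₂ (eβ i))))

  ⊕T-assoc : ∀ {n m r z s w} (S : TSet n m) (T : TSet r z) (U : TSet s w)
             (p : (n ℕ.+ r) ℕ.+ s ≡ n ℕ.+ (r ℕ.+ s)) (q : (m ℕ.+ z) ℕ.+ w ≡ m ℕ.+ (z ℕ.+ w)) →
             (λ ρ → ((S ⊕T T) ⊕T U) (castSig p q ρ)) ≐ (S ⊕T (T ⊕T U))
  ⊕T-assoc S T U p q ρ = to , from
    where
    to : ((S ⊕T T) ⊕T U) (castSig p q ρ) → (S ⊕T (T ⊕T U)) ρ
    to (X , σ₃ , (σ₁ , σ₂ , S₁ , S₂ , eX) , S₃ , e) =
      σ₁ , (λ i → lft σ₂ i ++ lft σ₃ i , rgt σ₂ i ++ rgt σ₃ i) , S₁ , (σ₂ , σ₃ , S₂ , S₃ , λ i → refl) ,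
      λ i → cong₂ _,_
        (trans (cast-transpose p (trans (cong proj₁ (e i)) (cong (_++ lft σ₃ i) (cong proj₁ (eX i)))))
               (++-assoc-eqFree (lft σ₁ i) (lft σ₂ i) (lft σ₃ i)))
        (trans (cast-transpose q (trans (cong proj₂ (e i)) (cong (_++ rgt σ₃ i) (cong proj₂ (eX i)))))
               (++-assoc-eqFree (rgt σ₁ i) (rgt σ₂ i) (rgt σ₃ i)))
    from : (S ⊕T (T ⊕T U)) ρ → ((S ⊕T T) ⊕T U) (castSig p q ρ)
    from (σ₁ , Y , S₁ , (σ₂ , σ₃ , S₂ , S₃ , eY) , e) =
      (λ i → lft σ₁ i ++ lft σ₂ i , rgt σ₁ i ++ rgt σ₂ i) , σ₃ , (σ₁ , σ₂ , S₁ , S₂ , λ i → refl) , S₃ ,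
      λ i → cong₂ _,_
        (trans (cong (cast (sym p)) (trans (cong proj₁ (e i)) (cong (lft σ₁ i ++_) (cong proj₁ (eY i)))))
               (cast-sym p (++-assoc-eqFree (lft σ₁ i) (lft σ₂ i) (lft σ₃ i))))
        (trans (cong (cast (sym q)) (trans (cong proj₂ (e i)) (cong (rgt σ₁ i ++_) (cong proj₂ (eY i)))))
               (cast-sym q (++-assoc-eqFree (rgt σ₁ i) (rgt σ₂ i) (rgt σ₃ i))))

  -- Interchange law of Traj; the converse direction uses that a boundary
  -- b₁ ++ b₂ determines b₁ and b₂.
  ⊕T-⨾T-interchange : ∀ {n z m r w q} (S : TSet n z) (T : TSet z m) (S' : TSet r w) (T' : TSet w q) →
                      ((S ⨾T T) ⊕T (S' ⨾T T')) ≐ ((S ⊕T S') ⨾T (T ⊕T T'))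
  ⊕T-⨾T-interchange S T S' T' ρ = to , from
    where
    to : ((S ⨾T T) ⊕T (S' ⨾T T')) ρ → ((S ⊕T S') ⨾T (T ⊕T T')) ρ
    to (A , B , (σ , τ , Sσ , Tτ , m₁ , eA) , (σ' , τ' , Sσ' , Tτ' , m₂ , eB) , e) =
      (λ i → lft σ i ++ lft σ' i , rgt σ i ++ rgt σ' i) , (λ i → lft τ i ++ lft τ' i , rgt τ i ++ rgt τ' i) ,
      (σ , σ' , Sσ , Sσ' , λ i → refl) , (τ , τ' , Tτ , Tτ' , λ i → refl) ,
      (λ i → cong₂ _++_ (m₁ i) (m₂ i)) ,
      (λ i → trans (e i) (cong₂ _,_ (cong₂ _++_ (cong proj₁ (eA i)) (cong proj₁ (eB i)))
                                    (cong₂ _++_ (cong proj₂ (eA i)) (cong proj₂ (eB i)))))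
    from : ((S ⊕T S') ⨾T (T ⊕T T')) ρ → ((S ⨾T T) ⊕T (S' ⨾T T')) ρ
    from (X , Y , (σ , σ' , Sσ , Sσ' , eX) , (τ , τ' , Tτ , Tτ' , eY) , mt , e) =
      (λ i → lft σ i , rgt τ i) , (λ i → lft σ' i , rgt τ' i) ,
      (σ , τ , Sσ , Tτ , (λ i → proj₁ (split i)) , (λ i → refl)) ,
      (σ' , τ' , Sσ' , Tτ' , (λ i → proj₂ (split i)) , (λ i → refl)) ,
      (λ i → trans (e i) (cong₂ _,_ (cong proj₁ (eX i)) (cong proj₂ (eY i))))
      where
      split : ∀ i → (rgt σ i ≡ lft τ i) × (rgt σ' i ≡ lft τ' i)
      split i = ++-injective (rgt σ i) (lft τ i)
                  (trans (sym (cong proj₂ (eX i))) (trans (mt i) (cong proj₁ (eY i))))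

  Run : ∀ {n m} → Circ n m → ℤ → Signal n m → Set
  Run c t σ = Σ (Computation c t) λ C → Yields C σ

  ⟦⟧-resp-≗ : ∀ {n m} (c : Circ n m) {σ σ' : Signal n m} → ⟦ c ⟧ σ → σ ≗ σ' → ⟦ c ⟧ σ'
  ⟦⟧-resp-≗ c (t , t≤0 , C , silent , labels) σ≗σ' =
    t , t≤0 , C , (λ i i<t → trans (sym (σ≗σ' i)) (silent i i<t)) , (λ j → trans (sym (σ≗σ' _)) (labels j))

  ⟦⟧-trajectory : ∀ {n m} (c : Circ n m) σ → ⟦ c ⟧ σ → IsTrajectory σ
  ⟦⟧-trajectory c σ (t , _ , _ , silent , _) =
    t ℤ.+ -[1+ 0 ] , λ i i≤t-1 → silent i (ℤP.≤-<-trans i≤t-1 (t+-[1+k]<t t 0))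

  step-resp : ∀ {t n m} {c : Circ n m} {s s'} {u u' : Vec K n} {v v' : Vec K m} →
              u ≡ u' → v ≡ v' → Step t c s u v s' → Step t c s u' v' s'
  step-resp refl refl step = step

  idle : ∀ {n m} (c : Circ n m) t → t ≢ + 0 →
         Step t c (init c) (replicate n 0ₖ) (replicate m 0ₖ) (init c)
  idle copy      t t≢0 = st-copy 0ₖ
  idle disc      t t≢0 = st-disc 0ₖ
  idle add       t t≢0 = step-resp refl (cong (_∷ []) (+ₖ-identityʳ 0ₖ)) (st-add 0ₖ 0ₖ)
  idle zero₀     t t≢0 = st-zero
  idle one       t t≢0 = st-one t≢0
  idle reg       t t≢0 = st-reg 0ₖ 0ₖ
  idle (amp r)   t t≢0 = step-resp refl (cong (_∷ []) (zeroʳ r)) (st-amp r 0ₖ)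
  idle copyᵒᵖ    t t≢0 = st-copyᵒᵖ 0ₖ
  idle discᵒᵖ    t t≢0 = st-discᵒᵖ 0ₖ
  idle addᵒᵖ     t t≢0 = step-resp (cong (_∷ []) (+ₖ-identityʳ 0ₖ)) refl (st-addᵒᵖ 0ₖ 0ₖ)
  idle zeroᵒᵖ    t t≢0 = st-zeroᵒᵖ
  idle oneᵒᵖ     t t≢0 = st-oneᵒᵖ t≢0
  idle regᵒᵖ     t t≢0 = st-regᵒᵖ 0ₖ 0ₖ
  idle (ampᵒᵖ r) t t≢0 = step-resp (cong (_∷ []) (zeroʳ r)) refl (st-ampᵒᵖ r 0ₖ)
  idle id₀       t t≢0 = st-id₀
  idle id₁       t t≢0 = st-id₁ 0ₖ
  idle sw        t t≢0 = st-sw 0ₖ 0ₖ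
  idle (c ⨾ d)   t t≢0 = st-seq (idle c t t≢0) (idle d t t≢0)
  idle (_⊕_ {n} {m} {r} {z} c d) t t≢0 =
    step-resp (sym (replicate-++ n r 0ₖ)) (sym (replicate-++ m z 0ₖ)) (st-par (idle c t t≢0) (idle d t t≢0))

  -- A run started at t + 1 can be started one step earlier, at t ≠ 0, by
  -- idling first; its trajectory is silent at t anyway.
  start-one-earlier : ∀ {n m} (c : Circ n m) {t σ} → t ≢ + 0 → Run c (t ℤ.+ + 1) σ → Run c t σ
  start-one-earlier {n} {m} c {t} {σ} t≢0 (C , silent , labels) = C' , silent' , labels'
    where
    module C = Computation C
    state : ℕ → State c
    state zero    = init c
    state (suc j) = C.state j
    left : ℕ → Vec K n
    left zero    = replicate n 0ₖ
    left (suc j) = C.left j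
    right : ℕ → Vec K m
    right zero    = replicate m 0ₖ
    right (suc j) = C.right j
    shift : ∀ j → t ℤ.+ + suc j ≡ (t ℤ.+ + 1) ℤ.+ + j
    shift j = sym (ℤP.+-assoc t (+ 1) (+ j))
    steps : ∀ j → Step (t ℤ.+ + j) c (state j) (left j) (right j) (state (suc j))
    steps zero    = subst₂ (λ t' s → Step t' c (init c) (left 0) (right 0) s)
                      (sym (ℤP.+-identityʳ t)) (sym C.start) (idle c t t≢0)
    steps (suc j) = subst (λ t' → Step t' c (C.state j) (C.left j) (C.right j) (C.state (suc j)))
                      (sym (shift j)) (C.steps j)
    C' : Computation c t
    C' = record { state = state ; start = refl ; left = left ; right = right ; steps = steps }
    t<t+1 : t ℤ.< t ℤ.+ + 1
    t<t+1 = subst (ℤ._< t ℤ.+ + 1) (ℤP.+-identityʳ t) (ℤP.+-monoʳ-< t (ℤ.+<+ (ℕ.s≤s ℕ.z≤n)))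
    silent' : ∀ i → i ℤ.< t → σ i ≡ zeros
    silent' i i<t = silent i (ℤP.<-trans i<t t<t+1)
    labels' : ∀ j → σ (t ℤ.+ + j) ≡ (left j , right j)
    labels' zero    = silent _ (subst (ℤ._< t ℤ.+ + 1) (sym (ℤP.+-identityʳ t)) t<t+1)
    labels' (suc j) = trans (cong σ (shift j)) (labels j)

  start-earlier-by : ∀ {n m} (c : Circ n m) {σ} d {t} → t ℤ.+ + d ℤ.≤ + 0 → Run c (t ℤ.+ + d) σ → Run c t σ
  start-earlier-by c {σ} zero    {t} _ R = subst (λ t' → Run c t' σ) (ℤP.+-identityʳ t) R
  start-earlier-by c {σ} (suc d) {t} t+d≤0 R =
    start-one-earlier c t≢0 (start-earlier-by c d (subst (ℤ._≤ + 0) shift t+d≤0) (subst (λ t' → Run c t' σ) shift R))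
    where
    shift : t ℤ.+ + suc d ≡ (t ℤ.+ + 1) ℤ.+ + d
    shift = sym (ℤP.+-assoc t (+ 1) (+ d))
    t≢0 : t ≢ + 0
    t≢0 t≡0 with subst (λ t' → t' ℤ.+ + suc d ℤ.≤ + 0) t≡0 t+d≤0
    ... | ℤ.+≤+ ()

  start-earlier : ∀ {n m} (c : Circ n m) {σ t t₁} → t ℤ.≤ t₁ → t₁ ℤ.≤ + 0 → Run c t₁ σ → Run c t σ
  start-earlier c {σ} {t} {t₁} t≤t₁ t₁≤0 R =
    start-earlier-by c ℤ.∣ t₁ ℤ.- t ∣ (subst (ℤ._≤ + 0) t₁≡t+d t₁≤0) (subst (λ t' → Run c t' σ) t₁≡t+d R)
    where
    t₁≡t+d : t₁ ≡ t ℤ.+ + ℤ.∣ t₁ ℤ.- t ∣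
    t₁≡t+d = sym (trans (cong (λ x → t ℤ.+ x) (ℤP.0≤i⇒+∣i∣≡i (ℤP.i≤j⇒0≤j-i t≤t₁))) (t+[i-t]≡i t t₁))

  common-start : ∀ {n m r z} (c : Circ n m) (d : Circ r z) {σ τ} →
                 ⟦ c ⟧ σ → ⟦ d ⟧ τ → ∃[ t ] (t ℤ.≤ + 0 × Run c t σ × Run d t τ)
  common-start c d (t₁ , t₁≤0 , R₁) (t₂ , t₂≤0 , R₂) with ℤP.≤-total t₁ t₂
  ... | inj₁ t₁≤t₂ = t₁ , t₁≤0 , R₁ , start-earlier d t₁≤t₂ t₂≤0 R₂
  ... | inj₂ t₂≤t₁ = t₂ , t₂≤0 , start-earlier c t₂≤t₁ t₁≤0 R₁ , R₂

  readAt : ∀ {n m} → (ℕ → Vec K n × Vec K m) → ℤ → Vec K n × Vec K m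
  readAt f (+ j)    = f j
  readAt f -[1+ _ ] = zeros

  trace : ∀ {n m} {c : Circ n m} {t} → Computation c t → Signal n m
  trace {t = t} C i = readAt (λ j → Computation.left C j , Computation.right C j) (i ℤ.- t)

  trace-run : ∀ {n m} {c : Circ n m} {t} (C : Computation c t) → Run c t (trace C)
  trace-run {t = t} C = C , silent , λ j → cong (readAt _) ([t+i]-t≡i t (+ j))
    where
    silent : ∀ i → i ℤ.< t → trace C i ≡ zeros
    silent i i<t with i ℤ.- t | t+[i-t]≡i t i
    ... | + j      | refl = contradiction i<t (t+j≮t t j)
    ... | -[1+ _ ] | _    = refl

  yields-trace : ∀ {n m} {c : Circ n m} {t} (C : Computation c t) {σ} → Yields C σ → σ ≗ trace C
  yields-trace {t = t} C {σ} (silent , labels) =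
    by-instant (λ i → σ i ≡ trace C i) t
      (λ i i<t → trans (silent i i<t) (sym (proj₁ (proj₂ (trace-run C)) i i<t)))
      (λ j → trans (labels j) (sym (proj₂ (proj₂ (trace-run C)) j)))

  step-⨾⁻¹ : ∀ {t n z m} {c : Circ n z} {d : Circ z m} {s u w s'} → Step t (c ⨾ d) s u w s' →
             ∃[ v ] (Step t c (proj₁ s) u v (proj₁ s') × Step t d (proj₂ s) v w (proj₂ s'))
  step-⨾⁻¹ (st-seq p q) = _ , p , q

  ⟦⨾⟧-split : ∀ {n z m} (c : Circ n z) (d : Circ z m) ρ → ⟦ c ⨾ d ⟧ ρ → (⟦ c ⟧ ⨾T ⟦ d ⟧) ρ
  ⟦⨾⟧-split {n} {z} {m} c d ρ (t , t≤0 , C , yields) =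
    trace C₁ , trace C₂ , (t , t≤0 , trace-run C₁) , (t , t≤0 , trace-run C₂) ,
    (λ i → boundary (i ℤ.- t)) , (λ i → trans (yields-trace C yields i) (outer (i ℤ.- t)))
    where
    module C = Computation C
    mid : ℕ → Vec K z
    mid j = proj₁ (step-⨾⁻¹ (C.steps j))
    C₁ : Computation c t
    C₁ = record { state = λ j → proj₁ (C.state j) ; start = cong proj₁ C.start
                ; left = C.left ; right = mid ; steps = λ j → proj₁ (proj₂ (step-⨾⁻¹ (C.steps j))) }
    C₂ : Computation d t
    C₂ = record { state = λ j → proj₂ (C.state j) ; start = cong proj₂ C.start
                ; left = mid ; right = C.right ; steps = λ j → proj₂ (proj₂ (step-⨾⁻¹ (C.steps j))) }
    boundary : ∀ x → proj₂ (readAt (λ j → C.left j , mid j) x) ≡ proj₁ (readAt (λ j → mid j , C.right j) x)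
    boundary (+ j)    = refl
    boundary -[1+ _ ] = refl
    outer : ∀ x → readAt (λ j → C.left j , C.right j) x
                ≡ (proj₁ (readAt (λ j → C.left j , mid j) x) , proj₂ (readAt (λ j → mid j , C.right j) x))
    outer (+ j)    = refl
    outer -[1+ _ ] = refl

  run-⨾ : ∀ {n z m} (c : Circ n z) (d : Circ z m) {σ τ ρ t} → Run c t σ → Run d t τ →
          (∀ i → rgt σ i ≡ lft τ i) → (∀ i → ρ i ≡ (lft σ i , rgt τ i)) → Run (c ⨾ d) t ρ
  run-⨾ c d {σ} {τ} {ρ} {t} (C₁ , silent₁ , labels₁) (C₂ , silent₂ , labels₂) boundary ρ≡ =
    C , silent , labels
    where
    module C₁ = Computation C₁
    module C₂ = Computation C₂
    agree : ∀ j → C₁.right j ≡ C₂.left j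
    agree j = trans (sym (cong proj₂ (labels₁ j))) (trans (boundary _) (cong proj₁ (labels₂ j)))
    C : Computation (c ⨾ d) t
    C = record { state = λ j → C₁.state j , C₂.state j ; start = cong₂ _,_ C₁.start C₂.start
               ; left = C₁.left ; right = C₂.right
               ; steps = λ j → st-seq (C₁.steps j) (step-resp (sym (agree j)) refl (C₂.steps j)) }
    silent : ∀ i → i ℤ.< t → ρ i ≡ zeros
    silent i i<t = trans (ρ≡ i) (cong₂ _,_ (cong proj₁ (silent₁ i i<t)) (cong proj₂ (silent₂ i i<t)))
    labels : ∀ j → ρ (t ℤ.+ + j) ≡ (C₁.left j , C₂.right j)
    labels j = trans (ρ≡ _) (cong₂ _,_ (cong proj₁ (labels₁ j)) (cong proj₂ (labels₂ j)))

  -- ⟦ c ⨾ d ⟧ = ⟦ c ⟧ ⨾T ⟦ d ⟧: split, or align the two runs and join them.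
  ⟦⨾⟧ : ∀ {n z m} (c : Circ n z) (d : Circ z m) → ⟦ c ⨾ d ⟧ ≐ (⟦ c ⟧ ⨾T ⟦ d ⟧)
  ⟦⨾⟧ c d ρ = ⟦⨾⟧-split c d ρ , join
    where
    join : (⟦ c ⟧ ⨾T ⟦ d ⟧) ρ → ⟦ c ⨾ d ⟧ ρ
    join (σ , τ , cσ , dτ , boundary , ρ≡) with common-start c d cσ dτ
    ... | t , t≤0 , R₁ , R₂ = t , t≤0 , run-⨾ c d R₁ R₂ boundary ρ≡

  record ParStep {n m r z} (t : ℤ) (c : Circ n m) (d : Circ r z) (s : State c × State d)
                 (u : Vec K (n ℕ.+ r)) (v : Vec K (m ℕ.+ z)) (s' : State c × State d) : Set where
    field
      u₁ : Vec K n
      u₂ : Vec K r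
      v₁ : Vec K m
      v₂ : Vec K z
      u≡ : u ≡ u₁ ++ u₂
      v≡ : v ≡ v₁ ++ v₂
      step₁ : Step t c (proj₁ s) u₁ v₁ (proj₁ s')
      step₂ : Step t d (proj₂ s) u₂ v₂ (proj₂ s')

  step-⊕⁻¹ : ∀ {t n m r z} {c : Circ n m} {d : Circ r z} {s u v s'} →
             Step t (c ⊕ d) s u v s' → ParStep t c d s u v s'
  step-⊕⁻¹ (st-par p q) = record { u≡ = refl ; v≡ = refl ; step₁ = p ; step₂ = q }

  ⟦⊕⟧-split : ∀ {n m r z} (c : Circ n m) (d : Circ r z) ρ → ⟦ c ⊕ d ⟧ ρ → (⟦ c ⟧ ⊕T ⟦ d ⟧) ρ
  ⟦⊕⟧-split {n} {m} {r} {z} c d ρ (t , t≤0 , C , yields) =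
    trace C₁ , trace C₂ , (t , t≤0 , trace-run C₁) , (t , t≤0 , trace-run C₂) ,
    (λ i → trans (yields-trace C yields i) (outer (i ℤ.- t)))
    where
    module C = Computation C
    open ParStep
    part : ∀ j → ParStep (t ℤ.+ + j) c d (C.state j) (C.left j) (C.right j) (C.state (suc j))
    part j = step-⊕⁻¹ (C.steps j)
    C₁ : Computation c t
    C₁ = record { state = λ j → proj₁ (C.state j) ; start = cong proj₁ C.start
                ; left = λ j → u₁ (part j) ; right = λ j → v₁ (part j) ; steps = λ j → step₁ (part j) }
    C₂ : Computation d t
    C₂ = record { state = λ j → proj₂ (C.state j) ; start = cong proj₂ C.start
                ; left = λ j → u₂ (part j) ; right = λ j → v₂ (part j) ; steps = λ j → step₂ (part j) }
    outer : ∀ x → readAt (λ j → C.left j , C.right j) x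
                ≡ (proj₁ (readAt (λ j → u₁ (part j) , v₁ (part j)) x) ++ proj₁ (readAt (λ j → u₂ (part j) , v₂ (part j)) x)
                  , proj₂ (readAt (λ j → u₁ (part j) , v₁ (part j)) x) ++ proj₂ (readAt (λ j → u₂ (part j) , v₂ (part j)) x))
    outer (+ j)    = cong₂ _,_ (u≡ (part j)) (v≡ (part j))
    outer -[1+ _ ] = cong₂ _,_ (replicate-++ n r 0ₖ) (replicate-++ m z 0ₖ)

  run-⊕ : ∀ {n m r z} (c : Circ n m) (d : Circ r z) {σ₁ σ₂ ρ t} → Run c t σ₁ → Run d t σ₂ →
          (∀ i → ρ i ≡ (lft σ₁ i ++ lft σ₂ i , rgt σ₁ i ++ rgt σ₂ i)) → Run (c ⊕ d) t ρ
  run-⊕ c d {σ₁} {σ₂} {ρ} {t} (C₁ , silent₁ , labels₁) (C₂ , silent₂ , labels₂) ρ≡ = C , silent , labels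
    where
    module C₁ = Computation C₁
    module C₂ = Computation C₂
    C : Computation (c ⊕ d) t
    C = record { state = λ j → C₁.state j , C₂.state j ; start = cong₂ _,_ C₁.start C₂.start
               ; left = λ j → C₁.left j ++ C₂.left j ; right = λ j → C₁.right j ++ C₂.right j
               ; steps = λ j → st-par (C₁.steps j) (C₂.steps j) }
    silent : ∀ i → i ℤ.< t → ρ i ≡ zeros
    silent i i<t = trans (ρ≡ i) (cong₂ _,_
      (++-silent (cong proj₁ (silent₁ i i<t)) (cong proj₁ (silent₂ i i<t)))
      (++-silent (cong proj₂ (silent₁ i i<t)) (cong proj₂ (silent₂ i i<t))))
    labels : ∀ j → ρ (t ℤ.+ + j) ≡ (C₁.left j ++ C₂.left j , C₁.right j ++ C₂.right j)
    labels j = trans (ρ≡ _) (cong₂ _,_ (cong₂ _++_ (cong proj₁ (labels₁ j)) (cong proj₁ (labels₂ j)))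
                                       (cong₂ _++_ (cong proj₂ (labels₁ j)) (cong proj₂ (labels₂ j))))

  ⟦⊕⟧ : ∀ {n m r z} (c : Circ n m) (d : Circ r z) → ⟦ c ⊕ d ⟧ ≐ (⟦ c ⟧ ⊕T ⟦ d ⟧)
  ⟦⊕⟧ c d ρ = ⟦⊕⟧-split c d ρ , join
    where
    join : (⟦ c ⟧ ⊕T ⟦ d ⟧) ρ → ⟦ c ⊕ d ⟧ ρ
    join (σ₁ , σ₂ , cσ₁ , dσ₂ , ρ≡) with common-start c d cσ₁ dσ₂
    ... | t , t≤0 , R₁ , R₂ = t , t≤0 , run-⊕ c d R₁ R₂ ρ≡

  record Computes {n m} (c : Circ n m) (f : Vec K n → Vec K m) : Set where
    field
      output : ∀ {t s u v s'} → Step t c s u v s' → v ≡ f u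
      stay   : ∀ t u → Step t c (init c) u (f u) (init c)
  open Computes

  graph : ∀ {n m} → (Vec K n → Vec K m) → TSet n m
  graph f ρ = IsTrajectory ρ × (∀ i → rgt ρ i ≡ f (lft ρ i))

  -- The behaviours of a circuit computing f form the graph of f.  (That f
  -- maps silence to silence follows from idling.)
  computes⇒graph : ∀ {n m} (c : Circ n m) {f} → Computes c f → ⟦ c ⟧ ≐ graph f
  computes⇒graph {n} {m} c {f} cf ρ = to , from
    where
    to : ⟦ c ⟧ ρ → graph f ρ
    to cρ@(t , _ , C , silent , labels) = ⟦⟧-trajectory c ρ cρ ,
      by-instant (λ i → rgt ρ i ≡ f (lft ρ i)) t
        (λ i i<t → trans (cong proj₂ (silent i i<t))
                     (trans (output cf (idle c -[1+ 0 ] (λ ()))) (cong f (sym (cong proj₁ (silent i i<t))))))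
        (λ j → trans (cong proj₂ (labels j))
                 (trans (output cf (Computation.steps C j)) (cong f (sym (cong proj₁ (labels j))))))
    run : ∀ {j₀} t → t ℤ.≤ + 0 → t ℤ.≤ j₀ → (∀ i → i ℤ.≤ j₀ → ρ i ≡ zeros) →
          (∀ i → rgt ρ i ≡ f (lft ρ i)) → ⟦ c ⟧ ρ
    run t t≤0 t≤j₀ silent onGraph =
      t , t≤0 , C , (λ i i<t → silent i (ℤP.≤-trans (ℤP.<⇒≤ i<t) t≤j₀)) , (λ j → cong (_ ,_) (onGraph _))
      where
      C : Computation c t
      C = record { state = λ _ → init c ; start = refl ; left = λ j → lft ρ (t ℤ.+ + j)
                 ; right = λ j → f (lft ρ (t ℤ.+ + j)) ; steps = λ j → stay cf _ _ }
    from : graph f ρ → ⟦ c ⟧ ρ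
    from ((j₀ , silent) , onGraph) with ℤP.≤-total (+ 0) j₀
    ... | inj₁ 0≤j₀ = run (+ 0) ℤP.≤-refl 0≤j₀ silent onGraph
    ... | inj₂ j₀≤0 = run j₀ j₀≤0 ℤP.≤-refl silent onGraph

  same-map⇒same-sem : ∀ {n m} (c d : Circ n m) {f g} → Computes c f → Computes d g → f ≗ g → ⟦ c ⟧ ≐ ⟦ d ⟧
  same-map⇒same-sem c d {f} {g} cf dg f≗g =
    ≐-trans (computes⇒graph c cf)
      (≐-trans (λ ρ → (λ (tr , e) → tr , λ i → trans (e i) (f≗g _)) , (λ (tr , e) → tr , λ i → trans (e i) (sym (f≗g _))))
        (≐-sym (computes⇒graph d dg)))

  computes-resp-≗ : ∀ {n m} (c : Circ n m) {f g} → Computes c f → f ≗ g → Computes c g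
  computes-resp-≗ c cf f≗g = record
    { output = λ step → trans (output cf step) (f≗g _)
    ; stay   = λ t u → step-resp refl (f≗g u) (stay cf t u) }

  computes-id₀ : Computes id₀ (λ u → u)
  computes-id₀ = record { output = λ { {u = []} {v = []} _ → refl } ; stay = λ { t [] → st-id₀ } }

  computes-id₁ : Computes id₁ (λ u → u)
  computes-id₁ = record { output = λ { (st-id₁ a) → refl } ; stay = λ { t (a ∷ []) → st-id₁ a } }

  computes-sw : Computes sw (swap 1 1)
  computes-sw = record { output = λ { (st-sw a b) → refl } ; stay = λ { t (a ∷ b ∷ []) → st-sw a b } }

  computes-⨾ : ∀ {n z m} (c : Circ n z) (d : Circ z m) {f g} → Computes c f → Computes d g →
               Computes (c ⨾ d) (λ u → g (f u))
  computes-⨾ c d {f} {g} cf dg = record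
    { output = λ step → let (v , p , q) = step-⨾⁻¹ step in trans (output dg q) (cong g (output cf p))
    ; stay   = λ t u → st-seq (stay cf t u) (stay dg t (f u)) }

  computes-⊕ : ∀ {n m r z} (c : Circ n m) (d : Circ r z) {f g} → Computes c f → Computes d g →
               Computes (c ⊕ d) (λ u → f (take n u) ++ g (drop n u))
  computes-⊕ {n} c d {f} {g} cf dg = record { output = out ; stay = λ t u →
    step-resp (take++drop≡id n u) refl (st-par (stay cf t (take n u)) (stay dg t (drop n u))) }
    where
    out : ∀ {t s u v s'} → Step t (c ⊕ d) s u v s' → v ≡ f (take n u) ++ g (drop n u)
    out (st-par {u₁ = u₁} {u₂ = u₂} p q) =
      trans (cong₂ _++_ (output cf p) (output dg q))
            (sym (cong₂ (λ a b → f a ++ g b) (take-++ u₁ u₂) (drop-++ u₁ u₂)))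

  computes-substˡ : ∀ {n n' m} (c : Circ n m) (p : n ≡ n') {f} → Computes c f →
                    Computes (subst (λ a → Circ a m) p c) (λ u → f (cast (sym p) u))
  computes-substˡ c refl {f} cf = computes-resp-≗ c cf (λ u → cong f (sym (cast-is-id refl u)))

  computes-substʳ : ∀ {n m m'} (c : Circ n m) (q : m ≡ m') {f} → Computes c f →
                    Computes (subst (Circ n) q c) (λ u → cast q (f u))
  computes-substʳ c refl cf = computes-resp-≗ c cf (λ u → sym (cast-is-id refl _))

  computes-subst₂ : ∀ {n n' m m'} (c : Circ n m) (p : n ≡ n') (q : m ≡ m') {f} → Computes c f →
                    Computes (subst₂ Circ p q c) (λ u → cast q (f (cast (sym p) u)))
  computes-subst₂ c refl refl {f} cf =
    computes-resp-≗ c cf (λ u → trans (cong f (sym (cast-is-id refl u))) (sym (cast-is-id refl _)))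

  computes-idC : ∀ n → Computes (idC n) (λ u → u)
  computes-idC zero    = computes-id₀
  computes-idC (suc n) =
    computes-resp-≗ (idC (suc n)) (computes-⊕ id₁ (idC n) computes-id₁ (computes-idC n)) (take++drop≡id 1)

  computes-τ : ∀ m → Computes (τ m) (swap 1 m)
  computes-τ zero    = computes-resp-≗ id₁ computes-id₁ (λ { (x ∷ []) → refl })
  computes-τ (suc m) = computes-resp-≗ (τ (suc m))
    (computes-⨾ (sw ⊕ idC m) (id₁ ⊕ τ m)
      (computes-⊕ sw (idC m) computes-sw (computes-idC m)) (computes-⊕ id₁ (τ m) computes-id₁ (computes-τ m)))
    (λ { (x ∷ y ∷ w) → refl })

  computes-σC : ∀ n m → Computes (σC n m) (swap n m)
  computes-σC zero m = computes-resp-≗ (σC zero m) (computes-substʳ (idC m) _ (computes-idC m))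
    (λ u → cast-sym (ℕP.+-identityʳ m) (++-identityʳ-eqFree u))
  computes-σC (suc n) m = computes-resp-≗ (σC (suc n) m)
    (computes-substʳ _ _ (computes-⨾ (id₁ ⊕ σC n m) (τ m ⊕ idC n)
      (computes-⊕ id₁ (σC n m) computes-id₁ (computes-σC n m)) (computes-⊕ (τ m) (idC n) (computes-τ m) (computes-idC n))))
    λ { (x ∷ u) → trans
          (cong (cast _) (cong₂ (λ a b → swap 1 m (x ∷ a) ++ b)
            (take-++ (drop n u) (take n u)) (drop-++ (drop n u) (take n u))))
          (++-assoc-eqFree (drop n u) (x ∷ []) (take n u)) }

  ⟦idC⟧ : ∀ n → ⟦ idC n ⟧ ≐ idT n
  ⟦idC⟧ n = ≐-trans (computes⇒graph (idC n) (computes-idC n))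
    (λ ρ → (λ (tr , e) → tr , λ i → sym (e i)) , (λ (tr , e) → tr , λ i → sym (e i)))

  ⟦σC⟧ : ∀ n m → ⟦ σC n m ⟧ ≐ symT n m
  ⟦σC⟧ n m = computes⇒graph (σC n m) (computes-σC n m)

  ⟦subst₂⟧ : ∀ {n n' m m'} (c : Circ n m) (p : n ≡ n') (q : m ≡ m') →
             ⟦ subst₂ Circ p q c ⟧ ≐ (λ ρ → ⟦ c ⟧ (castSig p q ρ))
  ⟦subst₂⟧ c refl refl ρ =
    (λ cρ → ⟦⟧-resp-≗ c cρ (λ i → sym (cong₂ _,_ (cast-is-id refl _) (cast-is-id refl _)))) ,
    (λ cρ → ⟦⟧-resp-≗ c cρ (λ i → cong₂ _,_ (cast-is-id refl _) (cast-is-id refl _)))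

  ⟦id₀⟧-full : ∀ σ → ⟦ id₀ ⟧ σ
  ⟦id₀⟧-full σ = proj₂ (computes⇒graph id₀ computes-id₀ σ)
    ((+ 0 , λ i _ → cong₂ _,_ ([]-unique _) ([]-unique _)) , λ i → trans ([]-unique _) (sym ([]-unique _)))

  idT-⨾T : ∀ {n m} (c : Circ n m) → (idT n ⨾T ⟦ c ⟧) ≐ ⟦ c ⟧
  idT-⨾T c ρ = to , from
    where
    to : (idT _ ⨾T ⟦ c ⟧) ρ → ⟦ c ⟧ ρ
    to (σ , τ , (_ , diag) , cτ , boundary , ρ≡) =
      ⟦⟧-resp-≗ c cτ (λ i → sym (trans (ρ≡ i) (cong (_, rgt τ i) (trans (diag i) (boundary i)))))
    from : ⟦ c ⟧ ρ → (idT _ ⨾T ⟦ c ⟧) ρ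
    from cρ with ⟦⟧-trajectory c ρ cρ
    ... | j , silent = (λ i → lft ρ i , lft ρ i) , ρ ,
          ((j , λ i i≤j → cong₂ _,_ (cong proj₁ (silent i i≤j)) (cong proj₁ (silent i i≤j))) , λ i → refl) ,
          cρ , (λ i → refl) , (λ i → refl)

  ⨾T-idT : ∀ {n m} (c : Circ n m) → (⟦ c ⟧ ⨾T idT m) ≐ ⟦ c ⟧
  ⨾T-idT c ρ = to , from
    where
    to : (⟦ c ⟧ ⨾T idT _) ρ → ⟦ c ⟧ ρ
    to (σ , τ , cσ , (_ , diag) , boundary , ρ≡) =
      ⟦⟧-resp-≗ c cσ (λ i → sym (trans (ρ≡ i) (cong (lft σ i ,_) (sym (trans (boundary i) (diag i))))))
    from : ⟦ c ⟧ ρ → (⟦ c ⟧ ⨾T idT _) ρ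
    from cρ with ⟦⟧-trajectory c ρ cρ
    ... | j , silent = ρ , (λ i → rgt ρ i , rgt ρ i) , cρ ,
          ((j , λ i i≤j → cong₂ _,_ (cong proj₂ (silent i i≤j)) (cong proj₂ (silent i i≤j))) , λ i → refl) ,
          (λ i → refl) , (λ i → refl)

  ⟦id₀⟧-⊕T : ∀ {n m} (c : Circ n m) → (⟦ id₀ ⟧ ⊕T ⟦ c ⟧) ≐ ⟦ c ⟧
  ⟦id₀⟧-⊕T c ρ =
    (λ (σ₁ , σ₂ , _ , cσ₂ , ρ≡) → ⟦⟧-resp-≗ c cσ₂ (λ i → sym (trans (ρ≡ i)
        (cong₂ _,_ (cong (_++ lft σ₂ i) ([]-unique _)) (cong (_++ rgt σ₂ i) ([]-unique _)))))) ,
    (λ cρ → (λ _ → [] , []) , ρ , ⟦id₀⟧-full _ , cρ , λ i → refl)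

  ⊕T-⟦id₀⟧ : ∀ {n m} (c : Circ n m) (p : n ℕ.+ 0 ≡ n) (q : m ℕ.+ 0 ≡ m) →
             (λ ρ → (⟦ c ⟧ ⊕T ⟦ id₀ ⟧) (castSig p q ρ)) ≐ ⟦ c ⟧
  ⊕T-⟦id₀⟧ c p q ρ = to , from
    where
    to : (⟦ c ⟧ ⊕T ⟦ id₀ ⟧) (castSig p q ρ) → ⟦ c ⟧ ρ
    to (σ₁ , σ₂ , cσ₁ , _ , ρ≡) = ⟦⟧-resp-≗ c cσ₁ λ i → sym (cong₂ _,_
      (trans (cast-transpose p (trans (cong proj₁ (ρ≡ i)) (cong (lft σ₁ i ++_) ([]-unique _))))
             (++-identityʳ-eqFree _))
      (trans (cast-transpose q (trans (cong proj₂ (ρ≡ i)) (cong (rgt σ₁ i ++_) ([]-unique _))))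
             (++-identityʳ-eqFree _)))
    from : ⟦ c ⟧ ρ → (⟦ c ⟧ ⊕T ⟦ id₀ ⟧) (castSig p q ρ)
    from cρ = ρ , (λ _ → [] , []) , cρ , ⟦id₀⟧-full _ ,
      λ i → cong₂ _,_ (cast-sym p (++-identityʳ-eqFree _)) (cast-sym q (++-identityʳ-eqFree _))

  -- Naturality of the symmetry: on both sides a behaviour is a pair of
  -- behaviours of c and d, with the outputs (resp. inputs) exchanged.
  swap-after-⊕T : ∀ {n m r z} (c : Circ n m) (d : Circ r z) →
                  ((⟦ c ⟧ ⊕T ⟦ d ⟧) ⨾T graph (swap m z)) ≐ (graph (swap n r) ⨾T (⟦ d ⟧ ⊕T ⟦ c ⟧))
  swap-after-⊕T {n} {m} {r} {z} c d ρ = to , from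
    where
    to : ((⟦ c ⟧ ⊕T ⟦ d ⟧) ⨾T graph (swap m z)) ρ → (graph (swap n r) ⨾T (⟦ d ⟧ ⊕T ⟦ c ⟧)) ρ
    to (X , Y , (σ₁ , σ₂ , cσ₁ , dσ₂ , X≡) , (_ , onGraph) , boundary , ρ≡) =
      inputs , (λ i → lft σ₂ i ++ lft σ₁ i , rgt σ₂ i ++ rgt σ₁ i) ,
      (silent-with⇒trajectory σ₁ σ₂ inputs (⟦⟧-trajectory c σ₁ cσ₁) (⟦⟧-trajectory d σ₂ dσ₂)
         (λ i e₁ e₂ → cong₂ _,_ (++-silent (cong proj₁ e₁) (cong proj₁ e₂)) (++-silent (cong proj₁ e₂) (cong proj₁ e₁))) ,
       λ i → sym (swap-++ (lft σ₁ i) (lft σ₂ i))) ,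
      (σ₂ , σ₁ , dσ₂ , cσ₁ , λ i → refl) , (λ i → refl) ,
      λ i → trans (ρ≡ i) (cong₂ _,_ (cong proj₁ (X≡ i))
        (trans (onGraph i) (trans (cong (swap m z) (trans (sym (boundary i)) (cong proj₂ (X≡ i))))
                                  (swap-++ (rgt σ₁ i) (rgt σ₂ i)))))
      where
      inputs : Signal (n ℕ.+ r) (r ℕ.+ n)
      inputs i = lft σ₁ i ++ lft σ₂ i , lft σ₂ i ++ lft σ₁ i
    from : (graph (swap n r) ⨾T (⟦ d ⟧ ⊕T ⟦ c ⟧)) ρ → ((⟦ c ⟧ ⊕T ⟦ d ⟧) ⨾T graph (swap m z)) ρ
    from (G , W , (_ , onGraph) , (σ₂ , σ₁ , dσ₂ , cσ₁ , W≡) , boundary , ρ≡) =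
      (λ i → lft σ₁ i ++ lft σ₂ i , rgt σ₁ i ++ rgt σ₂ i) , outputs ,
      (σ₁ , σ₂ , cσ₁ , dσ₂ , λ i → refl) ,
      (silent-with⇒trajectory σ₁ σ₂ outputs (⟦⟧-trajectory c σ₁ cσ₁) (⟦⟧-trajectory d σ₂ dσ₂)
         (λ i e₁ e₂ → cong₂ _,_ (++-silent (cong proj₂ e₁) (cong proj₂ e₂)) (++-silent (cong proj₂ e₂) (cong proj₂ e₁))) ,
       λ i → sym (swap-++ (rgt σ₁ i) (rgt σ₂ i))) ,
      (λ i → refl) ,
      λ i → trans (ρ≡ i) (cong₂ _,_
        (swap-++⁻¹ n r (lft G i) (lft σ₁ i) (lft σ₂ i)
          (trans (sym (onGraph i)) (trans (boundary i) (cong proj₁ (W≡ i)))))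
        (cong proj₂ (W≡ i)))
      where
      outputs : Signal (m ℕ.+ z) (z ℕ.+ m)
      outputs i = rgt σ₁ i ++ rgt σ₂ i , rgt σ₂ i ++ rgt σ₁ i

  -- The hexagon law: both sides exchange the first n wires with the other m + r.
  module Hexagon (n m r : ℕ) where
    αₙₘᵣ : (n ℕ.+ m) ℕ.+ r ≡ n ℕ.+ (m ℕ.+ r)
    αₙₘᵣ = ℕP.+-assoc n m r
    αₘₙᵣ : (m ℕ.+ n) ℕ.+ r ≡ m ℕ.+ (n ℕ.+ r)
    αₘₙᵣ = ℕP.+-assoc m n r
    αₘᵣₙ : (m ℕ.+ r) ℕ.+ n ≡ m ℕ.+ (r ℕ.+ n)
    αₘᵣₙ = ℕP.+-assoc m r n

    -- the maps computed by σC n m ⊕ idC r and idC m ⊕ σC n r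
    swap₁ : Vec K ((n ℕ.+ m) ℕ.+ r) → Vec K ((m ℕ.+ n) ℕ.+ r)
    swap₁ v = swap n m (take (n ℕ.+ m) v) ++ drop (n ℕ.+ m) v
    swap₂ : Vec K (m ℕ.+ (n ℕ.+ r)) → Vec K (m ℕ.+ (r ℕ.+ n))
    swap₂ w = take m w ++ swap n r (drop m w)

    lhs : Vec K (n ℕ.+ (m ℕ.+ r)) → Vec K ((m ℕ.+ r) ℕ.+ n)
    lhs u = cast (sym αₘᵣₙ) (swap₂ (cast αₘₙᵣ (swap₁ (cast (sym αₙₘᵣ) u))))

    lhs-blocks : ∀ (a : Vec K n) (b : Vec K m) (c : Vec K r) → lhs (a ++ (b ++ c)) ≡ (b ++ c) ++ a
    lhs-blocks a b c = begin
      lhs (a ++ (b ++ c))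
        ≡⟨ cong (λ v → cast (sym αₘᵣₙ) (swap₂ (cast αₘₙᵣ (swap₁ v)))) (cast-sym αₙₘᵣ (++-assoc-eqFree a b c)) ⟩
      cast (sym αₘᵣₙ) (swap₂ (cast αₘₙᵣ (swap₁ ((a ++ b) ++ c))))
        ≡⟨ cong (λ v → cast (sym αₘᵣₙ) (swap₂ (cast αₘₙᵣ v))) swap₁-blocks ⟩
      cast (sym αₘᵣₙ) (swap₂ (cast αₘₙᵣ ((b ++ a) ++ c)))
        ≡⟨ cong (λ v → cast (sym αₘᵣₙ) (swap₂ v)) (++-assoc-eqFree b a c) ⟩
      cast (sym αₘᵣₙ) (swap₂ (b ++ (a ++ c)))
        ≡⟨ cong (cast (sym αₘᵣₙ)) swap₂-blocks ⟩
      cast (sym αₘᵣₙ) (b ++ (c ++ a))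
        ≡⟨ cast-sym αₘᵣₙ (++-assoc-eqFree b c a) ⟩
      (b ++ c) ++ a ∎
      where
      open ≡-Reasoning
      swap₁-blocks : swap₁ ((a ++ b) ++ c) ≡ (b ++ a) ++ c
      swap₁-blocks = cong₂ _++_ (trans (cong (swap n m) (take-++ (a ++ b) c)) (swap-++ a b)) (drop-++ (a ++ b) c)
      swap₂-blocks : swap₂ (b ++ (a ++ c)) ≡ b ++ (c ++ a)
      swap₂-blocks = cong₂ _++_ (take-++ b (a ++ c)) (trans (cong (swap n r) (drop-++ b (a ++ c))) (swap-++ a c))

    lhs≗swap : lhs ≗ swap n (m ℕ.+ r)
    lhs≗swap u = begin
      lhs u                                 ≡⟨ cong lhs (sym blocks) ⟩
      lhs (a ++ (b ++ c))                   ≡⟨ lhs-blocks a b c ⟩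
      (b ++ c) ++ a                         ≡⟨ sym (swap-++ a (b ++ c)) ⟩
      swap n (m ℕ.+ r) (a ++ (b ++ c))      ≡⟨ cong (swap n (m ℕ.+ r)) blocks ⟩
      swap n (m ℕ.+ r) u                    ∎
      where
      open ≡-Reasoning
      a : Vec K n
      a = take n u
      b : Vec K m
      b = take m (drop n u)
      c : Vec K r
      c = drop m (drop n u)
      blocks : a ++ (b ++ c) ≡ u
      blocks = trans (cong (take n u ++_) (take++drop≡id m (drop n u))) (take++drop≡id n u)

    hexagon : ⟦ subst (λ a → Circ a ((m ℕ.+ r) ℕ.+ n)) αₙₘᵣ
                  ((σC n m ⊕ idC r) ⨾ subst₂ Circ (sym αₘₙᵣ) (sym αₘᵣₙ) (idC m ⊕ σC n r)) ⟧
              ≐ ⟦ σC n (m ℕ.+ r) ⟧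
    hexagon = same-map⇒same-sem _ _
      (computes-substˡ _ αₙₘᵣ (computes-⨾ _ _
        (computes-⊕ (σC n m) (idC r) (computes-σC n m) (computes-idC r))
        (computes-subst₂ (idC m ⊕ σC n r) _ _ (computes-⊕ (idC m) (σC n r) (computes-idC m) (computes-σC n r)))))
      (computes-σC n (m ℕ.+ r)) lhs≗swap

  -- The laws about
  -- ⨾ and ⊕ follow by compositionality from the corresponding laws of Traj;
  -- those about wiring from the maps the two sides compute.
  ⟦⟧-sound : ∀ {n m} {c d : Circ n m} → c ≈ d → ⟦ c ⟧ ≐ ⟦ d ⟧
  ⟦⟧-sound ≈-refl        = ≐-refl
  ⟦⟧-sound (≈-sym p)     = ≐-sym (⟦⟧-sound p)
  ⟦⟧-sound (≈-trans p q) = ≐-trans (⟦⟧-sound p) (⟦⟧-sound q)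
  ⟦⟧-sound (⨾-cong {c = c} {c'} {d} {d'} p q) =
    ≐-trans (⟦⨾⟧ c d) (≐-trans (⨾T-cong (⟦⟧-sound p) (⟦⟧-sound q)) (≐-sym (⟦⨾⟧ c' d')))
  ⟦⟧-sound (⊕-cong {c = c} {c'} {d} {d'} p q) =
    ≐-trans (⟦⊕⟧ c d) (≐-trans (⊕T-cong (⟦⟧-sound p) (⟦⟧-sound q)) (≐-sym (⟦⊕⟧ c' d')))
  ⟦⟧-sound (⨾-assoc c d e) =
    ≐-trans (⟦⨾⟧ (c ⨾ d) e) (≐-trans (⨾T-cong (⟦⨾⟧ c d) ≐-refl)
    (≐-trans (⨾T-assoc ⟦ c ⟧ ⟦ d ⟧ ⟦ e ⟧)
    (≐-trans (⨾T-cong ≐-refl (≐-sym (⟦⨾⟧ d e))) (≐-sym (⟦⨾⟧ c (d ⨾ e))))))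
  ⟦⟧-sound (⨾-idˡ {n} c) = ≐-trans (⟦⨾⟧ (idC n) c) (≐-trans (⨾T-cong (⟦idC⟧ n) ≐-refl) (idT-⨾T c))
  ⟦⟧-sound (⨾-idʳ {m = m} c) = ≐-trans (⟦⨾⟧ c (idC m)) (≐-trans (⨾T-cong ≐-refl (⟦idC⟧ m)) (⨾T-idT c))
  ⟦⟧-sound (⊕-assoc {n} {m} {r} {z} {s} {w} c d e) =
    ≐-trans (⟦subst₂⟧ ((c ⊕ d) ⊕ e) αₗ αᵣ)
    (≐-trans (≐-castSig αₗ αᵣ (≐-trans (⟦⊕⟧ (c ⊕ d) e) (⊕T-cong (⟦⊕⟧ c d) ≐-refl)))
    (≐-trans (⊕T-assoc ⟦ c ⟧ ⟦ d ⟧ ⟦ e ⟧ αₗ αᵣ)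
    (≐-sym (≐-trans (⟦⊕⟧ c (d ⊕ e)) (⊕T-cong ≐-refl (⟦⊕⟧ d e))))))
    where
    αₗ : (n ℕ.+ r) ℕ.+ s ≡ n ℕ.+ (r ℕ.+ s)
    αₗ = ℕP.+-assoc n r s
    αᵣ : (m ℕ.+ z) ℕ.+ w ≡ m ℕ.+ (z ℕ.+ w)
    αᵣ = ℕP.+-assoc m z w
  ⟦⟧-sound (⊕-idˡ c) = ≐-trans (⟦⊕⟧ id₀ c) (⟦id₀⟧-⊕T c)
  ⟦⟧-sound (⊕-idʳ {n} {m} c) =
    ≐-trans (⟦subst₂⟧ (c ⊕ id₀) ρₗ ρᵣ) (≐-trans (≐-castSig ρₗ ρᵣ (⟦⊕⟧ c id₀)) (⊕T-⟦id₀⟧ c ρₗ ρᵣ))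
    where
    ρₗ : n ℕ.+ 0 ≡ n
    ρₗ = ℕP.+-identityʳ n
    ρᵣ : m ℕ.+ 0 ≡ m
    ρᵣ = ℕP.+-identityʳ m
  ⟦⟧-sound (interchange c d c' d') =
    ≐-trans (⟦⊕⟧ (c ⨾ d) (c' ⨾ d')) (≐-trans (⊕T-cong (⟦⨾⟧ c d) (⟦⨾⟧ c' d'))
    (≐-trans (⊕T-⨾T-interchange ⟦ c ⟧ ⟦ d ⟧ ⟦ c' ⟧ ⟦ d' ⟧)
    (≐-trans (⨾T-cong (≐-sym (⟦⊕⟧ c c')) (≐-sym (⟦⊕⟧ d d'))) (≐-sym (⟦⨾⟧ (c ⊕ c') (d ⊕ d'))))))
  ⟦⟧-sound (id-⊕ n m) =
    same-map⇒same-sem _ _ (computes-⊕ (idC n) (idC m) (computes-idC n) (computes-idC m))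
      (computes-idC (n ℕ.+ m)) (take++drop≡id n)
  ⟦⟧-sound (σ-inv n m) =
    same-map⇒same-sem _ _ (computes-⨾ (σC n m) (σC m n) (computes-σC n m) (computes-σC m n))
      (computes-idC (n ℕ.+ m)) (λ u → trans (swap-++ (drop n u) (take n u)) (take++drop≡id n u))
  ⟦⟧-sound (σ-nat {n} {m} {r} {z} c d) =
    ≐-trans (⟦⨾⟧ (c ⊕ d) (σC m z))
    (≐-trans (⨾T-cong (⟦⊕⟧ c d) (⟦σC⟧ m z))
    (≐-trans (swap-after-⊕T c d)
    (≐-sym (≐-trans (⟦⨾⟧ (σC n r) (d ⊕ c)) (⨾T-cong (⟦σC⟧ n r) (⟦⊕⟧ d c))))))
  ⟦⟧-sound (σ-hex n m r) = Hexagon.hexagon n m r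

theorem1 : (F : Field) → let open Semantics F in
    (∀ {n m} {c d : Circ n m} → c ≈ d → ⟦ c ⟧ ≐ ⟦ d ⟧) ×
    (∀ {n m} (c : Circ n m) σ → ⟦ c ⟧ σ → IsTrajectory σ) ×
    (∀ {n z m} (c : Circ n z) (d : Circ z m) → ⟦ c ⨾ d ⟧ ≐ (⟦ c ⟧ ⨾T ⟦ d ⟧)) ×
    (∀ {n m r z} (c : Circ n m) (d : Circ r z) → ⟦ c ⊕ d ⟧ ≐ (⟦ c ⟧ ⊕T ⟦ d ⟧)) ×
    (∀ n → ⟦ idC n ⟧ ≐ idT n) ×
    (∀ n m → ⟦ σC n m ⟧ ≐ symT n m)
theorem1 F = ⟦⟧-sound , ⟦⟧-trajectory , ⟦⨾⟧ , ⟦⊕⟧ , ⟦idC⟧ , ⟦σC⟧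
  where open Soundness F
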